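{- Let $\mathrm{qmsg}$ be the queue automaton. For every state $(\mathit{msgs}, q) \in \mathrm{reachable}\ \mathrm{qmsg}\ (\lambda a.\ \mathrm{True})$ and every transition $((\mathit{msgs}, q), a, s') \in \mathrm{trans}\ \mathrm{qmsg}$, if $a = \mathrm{send}\ m$ for some message $m$, then $m \in \mathrm{set}\ \mathit{msgs}$.
   Context: Data states of the queue are lists of messages; $@$ is list concatenation, $\mathrm{hd}$ and $\mathrm{tl}$ are head and tail, and $\mathrm{set}$ gives the set of elements of a list. The specification $\Gamma_{qmsg}$ has one process name $\mathrm{Qmsg}$ with (labels omitted) $\Gamma_{qmsg}\,\mathrm{Qmsg} = \mathrm{receive}(\lambda msg\ msgs.\ msgs@[msg]).\mathrm{call}(\mathrm{Qmsg}) \ \oplus\ \langle\lambda msgs.\ \text{if } msgs\neq[\,] \text{ then } \{msgs\} \text{ else } \emptyset\rangle\big(\mathrm{send}(\lambda msgs.\ \mathrm{hd}\,msgs).\big([\![\lambda msgs.\ \mathrm{tl}\,msgs]\!]\,\mathrm{call}(\mathrm{Qmsg}) \oplus \mathrm{receive}(\lambda msg\ msgs.\ \mathrm{tl}\,msgs@[msg]).\mathrm{call}(\mathrm{Qmsg})\big) \oplus \mathrm{receive}(\lambda msg\ msgs.\ msgs@[msg]).\mathrm{call}(\mathrm{Qmsg})\big)$. States are pairs $(\xi,p)$ of a data state and a process term, with the operational semantics: $(\xi,[\![u]\!]p)\xrightarrow{\tau}(u\,\xi,p)$; $(\xi,\langle g\rangle p)\xrightarrow{\tau}(\xi',p)$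 for each $\xi'\in g\,\xi$; $(\xi,\mathrm{send}(s).p)\xrightarrow{\mathrm{send}(s\,\xi)}(\xi,p)$; $(\xi,\mathrm{receive}(u).p)\xrightarrow{\mathrm{receive}\,m}(u\,m\,\xi,p)$ for every message $m$; $(\xi,p\oplus q)$ has all transitions of $(\xi,p)$ and of $(\xi,q)$; $(\xi,\mathrm{call}(pn))$ has all transitions of $(\xi,\Gamma\,pn)$. The automaton $\mathrm{qmsg}$ has initial states $\{([\,],\Gamma_{qmsg}\,\mathrm{Qmsg})\}$ and transitions given by this semantics for $\Gamma_{qmsg}$. For an automaton $A$ and action predicate $I$, $\mathrm{reachable}\ A\ I$ is the smallest set containing the initial states and closed under transitions $(s,a,s')$ with $I\,a$. -}

module Defs where

open import Data.List using (List; []; _∷_; _++_; [_])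
open import Data.Product using (_×_; _,_)
open import Relation.Binary.PropositionalEquality using (_≡_; _≢_)

-- Generic process calculus (labels omitted), parametrised by
-- process names PN, data states S and messages M.
data Proc (PN S M : Set) : Set₁ where
  ⟦_⟧_     : (S → S) → Proc PN S M → Proc PN S M
  ⟨_⟩_     : (S → S → Set) → Proc PN S M → Proc PN S M    -- guard <g>p ; g ξ ξ' means ξ' ∈ g ξ
  send     : (S → M) → Proc PN S M → Proc PN S M
  receive  : (M → S → S) → Proc PN S M → Proc PN S M
  _⊕_      : Proc PN S M → Proc PN S M → Proc PN S M
  call     : PN → Proc PN S M

infixr 20 ⟦_⟧_ ⟨_⟩_
infixr 10 _⊕_

data Action (M : Set) : Set where
  τ       : Action M
  sendA   : M → Action M
  receiveA : M → Action M

State : (PN S M : Set) → Set₁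
State PN S M = S × Proc PN S M

data Step {PN S M : Set} (Γ : PN → Proc PN S M) :
          State PN S M → Action M → State PN S M → Set₁ where
  s-assign  : ∀ {ξ u p} → Step Γ (ξ , ⟦ u ⟧ p) τ (u ξ , p)
  s-guard   : ∀ {ξ ξ' g p} → g ξ ξ' → Step Γ (ξ , ⟨ g ⟩ p) τ (ξ' , p)
  s-send    : ∀ {ξ s p} → Step Γ (ξ , send s p) (sendA (s ξ)) (ξ , p)
  s-receive : ∀ {ξ u p} m → Step Γ (ξ , receive u p) (receiveA m) (u m ξ , p)
  s-choiceˡ : ∀ {ξ p q a s'} → Step Γ (ξ , p) a s' → Step Γ (ξ , p ⊕ q) a s'
  s-choiceʳ : ∀ {ξ p q a s'} → Step Γ (ξ , q) a s' → Step Γ (ξ , p ⊕ q) a s'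
  s-call    : ∀ {ξ pn a s'} → Step Γ (ξ , Γ pn) a s' → Step Γ (ξ , call pn) a s'

record Automaton (St : Set₁) (Act : Set) : Set₂ where
  field
    init  : St → Set₁
    trans : St → Act → St → Set₁
open Automaton public

data reachable {St : Set₁} {Act : Set} (A : Automaton St Act) (I : Act → Set) : St → Set₁ where
  r-init : ∀ {s} → init A s → reachable A I s
  r-step : ∀ {s a s'} → reachable A I s → trans A s a s' → I a → reachable A I s'

data QName : Set where
  Qmsg : QName

-- hd: Isabelle's hd [] is an unspecified message; we take it as a parameter d.
hd : {M : Set} → M → List M → M
hd d []      = d
hd d (x ∷ _) = x

tl : {M : Set} → List M → List M
tl []       = []
tl (_ ∷ xs) = xs

nonEmptyGuard : {M : Set} → List M → List M → Set
nonEmptyGuard msgs ξ' = (msgs ≢ []) × (ξ' ≡ msgs)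

Γqmsg : {M : Set} → M → QName → Proc QName (List M) M
Γqmsg d Qmsg =
  receive (λ msg msgs → msgs ++ [ msg ]) (call Qmsg)
  ⊕ ⟨ nonEmptyGuard ⟩
      ( send (λ msgs → hd d msgs)
          ( (⟦ (λ msgs → tl msgs) ⟧ call Qmsg)
            ⊕ receive (λ msg msgs → tl msgs ++ [ msg ]) (call Qmsg))
      ⊕ receive (λ msg msgs → msgs ++ [ msg ]) (call Qmsg))

qmsg : {M : Set} → M → Automaton (State QName (List M) M) (Action M)
qmsg d = record
  { init  = λ s → s ≡ ([] , Γqmsg d Qmsg)
  ; trans = Step (Γqmsg d)
  }

-- The control state of the queue only ever sits at the body of Qmsg, at a call
-- of Qmsg, just after the guard (which leaves the queue non-empty), or just
-- after the send.  The only send is the head of a queue that passed the guard,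
-- hence a member of it.
module Submission where

open import Defs
open import Data.List using (List; []; _∷_; _++_; [_])
open import Data.List.Membership.Propositional using (_∈_)
open import Data.List.Relation.Unary.Any using (here)
open import Data.Unit using (⊤)
open import Data.Product using (_,_)
open import Data.Empty using (⊥-elim)
open import Relation.Nullary using (¬_)
open import Relation.Binary.PropositionalEquality using (_≡_; _≢_; refl)

reachable-invariant : ∀ {ℓ} {St : Set₁} {Act : Set} {A : Automaton St Act} {I : Act → Set}
                      (P : St → Set ℓ) →
                      (∀ {s} → init A s → P s) →
                      (∀ {s a s'} → P s → trans A s a s' → P s') →
                      ∀ {s} → reachable A I s → P s
reachable-invariant P init⇒P step-pres (r-init i)      = init⇒P i
reachable-invariant P init⇒P step-pres (r-step r st _) = step-pres (reachable-invariant P init⇒P step-pres r) st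

hd-∈ : {M : Set} (d : M) {xs : List M} → xs ≢ [] → hd d xs ∈ xs
hd-∈ d {[]}    xs≢[] = ⊥-elim (xs≢[] refl)
hd-∈ d {x ∷ _} _     = here refl

module _ {M : Set} (d : M) where

  Proc-qmsg : Set₁
  Proc-qmsg = Proc QName (List M) M

  Step-qmsg : State QName (List M) M → Action M → State QName (List M) M → Set₁
  Step-qmsg = Step (Γqmsg d)

  after-send : Proc-qmsg
  after-send = (⟦ (λ msgs → tl msgs) ⟧ call Qmsg)
               ⊕ receive (λ msg msgs → tl msgs ++ [ msg ]) (call Qmsg)

  after-guard : Proc-qmsg
  after-guard = send (λ msgs → hd d msgs) after-send
                ⊕ receive (λ msg msgs → msgs ++ [ msg ]) (call Qmsg)

  data QmsgControl : State QName (List M) M → Set₁ where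
    at-body  : ∀ {ξ} → QmsgControl (ξ , Γqmsg d Qmsg)
    at-call  : ∀ {ξ} → QmsgControl (ξ , call Qmsg)
    at-guard : ∀ {ξ} → ξ ≢ [] → QmsgControl (ξ , after-guard)
    at-sent  : ∀ {ξ} → QmsgControl (ξ , after-send)

  body-step-control : ∀ {ξ a s'} → Step-qmsg (ξ , Γqmsg d Qmsg) a s' → QmsgControl s'
  body-step-control (s-choiceˡ (s-receive _))           = at-call
  body-step-control (s-choiceʳ (s-guard (ξ≢[] , refl))) = at-guard ξ≢[]

  step-control : ∀ {s a s'} → QmsgControl s → Step-qmsg s a s' → QmsgControl s'
  step-control at-body      st                        = body-step-control st
  step-control at-call      (s-call st)               = body-step-control st
  step-control (at-guard _) (s-choiceˡ s-send)        = at-sent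
  step-control (at-guard _) (s-choiceʳ (s-receive _)) = at-call
  step-control at-sent      (s-choiceˡ s-assign)      = at-call
  step-control at-sent      (s-choiceʳ (s-receive _)) = at-call

  reachable-control : ∀ {s} → reachable (qmsg d) (λ _ → ⊤) s → QmsgControl s
  reachable-control = reachable-invariant QmsgControl (λ { refl → at-body }) step-control

  ¬body-sends : ∀ {ξ m s'} → ¬ Step-qmsg (ξ , Γqmsg d Qmsg) (sendA m) s'
  ¬body-sends (s-choiceˡ ())
  ¬body-sends (s-choiceʳ ())

  control-send-∈ : ∀ {ξ q m s'} → QmsgControl (ξ , q) → Step-qmsg (ξ , q) (sendA m) s' → m ∈ ξ
  control-send-∈ at-body         st                 = ⊥-elim (¬body-sends st)
  control-send-∈ at-call         (s-call st)        = ⊥-elim (¬body-sends st)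
  control-send-∈ (at-guard ξ≢[]) (s-choiceˡ s-send) = hd-∈ d ξ≢[]
  control-send-∈ (at-guard _)    (s-choiceʳ ())
  control-send-∈ at-sent         (s-choiceˡ ())
  control-send-∈ at-sent         (s-choiceʳ ())

lemma4 : {M : Set} (d : M) (msgs : List M) (q : Proc QName (List M) M)
         (a : Action M) (s' : State QName (List M) M) →
         reachable (qmsg d) (λ _ → ⊤) (msgs , q) →
         trans (qmsg d) (msgs , q) a s' →
         ∀ (m : M) → a ≡ sendA m → m ∈ msgs
lemma4 d msgs q .(sendA m) s' r st m refl = control-send-∈ d (reachable-control d r) st
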